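{- Let $\mathcal{H}$ be a 3-uniform hypergraph containing no copy of $\mathcal{M}$ and let $\mathcal{H}'$ be its 13-core. Then for every vertex $v \in V(\mathcal{H}')$, the vertex cover number $\tau(Tr_{\mathcal{H}'}(v))$ is neither 2 nor 3.
   Context: The messy path $\mathcal{M}$ is $\{abc, bcd, def\}$ on six distinct vertices. The 13-core is obtained by iteratively deleting vertices of degree less than 13 (with their triples) until all remaining vertices have degree at least 13. $Tr_{\mathcal{H}'}(v) = \{ e \setminus \{v\} : e \in \mathcal{H}', v \in e\}$ is the trace graph of $v$; $\tau$ is the minimum size of a set of vertices meeting every edge. -}

module Defs where

open import Data.Nat using (ℕ; _<_; _≥_)
open import Data.Fin using (Fin)
open import Data.Fin.Subset using (Subset; ⁅_⁆; _∪_; _∩_; _-_; ∣_∣; _∈_; _∉_; _⊆_; Nonempty)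
open import Data.Fin.Subset.Properties using (_∈?_; _⊆?_)
open import Data.List using (List; length; filter; map)
open import Data.List.Relation.Unary.All using (All)
open import Data.List.Relation.Unary.Unique.Propositional using (Unique)
import Data.List.Membership.Propositional as L
open import Data.Product using (Σ; ∃; _×_)
open import Relation.Binary.PropositionalEquality using (_≡_; _≢_)
open import Relation.Nullary using (¬_)

record Hypergraph3 (n : ℕ) : Set where
  field
    edges   : List (Subset n)
    uniform : All (λ e → ∣ e ∣ ≡ 3) edges
    simple  : Unique edges
open Hypergraph3 public

triple : ∀ {n} → Fin n → Fin n → Fin n → Subset n
triple a b c = ⁅ a ⁆ ∪ (⁅ b ⁆ ∪ ⁅ c ⁆)

-- H contains a copy of the messy path {abc, bcd, def} on six distinct vertices.
ContainsMessyPath : ∀ {n} → Hypergraph3 n → Set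
ContainsMessyPath {n} H =
  Σ (Fin n) λ a → Σ (Fin n) λ b → Σ (Fin n) λ c →
  Σ (Fin n) λ d → Σ (Fin n) λ e → Σ (Fin n) λ f →
    (a ≢ b) × (a ≢ c) × (a ≢ d) × (a ≢ e) × (a ≢ f) ×
    (b ≢ c) × (b ≢ d) × (b ≢ e) × (b ≢ f) ×
    (c ≢ d) × (c ≢ e) × (c ≢ f) ×
    (d ≢ e) × (d ≢ f) ×
    (e ≢ f) ×
    (triple a b c L.∈ edges H) ×
    (triple b c d L.∈ edges H) ×
    (triple d e f L.∈ edges H)

edgesIn : ∀ {n} → Hypergraph3 n → Subset n → List (Subset n)
edgesIn H W = filter (_⊆? W) (edges H)

degIn : ∀ {n} → Hypergraph3 n → Subset n → Fin n → ℕ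
degIn H W v = length (filter (v ∈?_) (edgesIn H W))

data Deletes {n : ℕ} (H : Hypergraph3 n) (k : ℕ) : Subset n → Subset n → Set where
  done : ∀ {W} → Deletes H k W W
  step : ∀ {W W'} (v : Fin n) → v ∈ W → degIn H W v < k →
         Deletes H k (W - v) W' → Deletes H k W W'

-- The k-core itself is the subhypergraph induced on W (edges: edgesIn H W).
IsCore : ∀ {n} → Hypergraph3 n → ℕ → Subset n → Set
IsCore {n} H k W = Deletes H k Data.Fin.Subset.⊤ W × (∀ v → v ∈ W → degIn H W v ≥ k)

trace : ∀ {n} → Hypergraph3 n → Subset n → Fin n → List (Subset n)
trace H W v = map (_- v) (filter (v ∈?_) (edgesIn H W))

IsCover : ∀ {n} → List (Subset n) → Subset n → Set
IsCover T C = All (λ e → Nonempty (e ∩ C)) T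

CoverNumber : ∀ {n} → List (Subset n) → ℕ → Set
CoverNumber {n} T t =
  (Σ (Subset n) λ C → IsCover T C × ∣ C ∣ ≡ t) ×
  (∀ (C : Subset n) → IsCover T C → ∣ C ∣ ≥ t)

module Submission where

-- Let v be a vertex of a subhypergraph H' of a messy-path-free 3-uniform
-- hypergraph H in which every vertex has degree at least 13 (the 13-core is
-- such a subhypergraph; only this minimum-degree property is used), and let T
-- be the trace of v.  We show that T has no vertex cover C with 2 ≤ τ(T) and
-- |C| ≤ 3.  Suppose it had one.
--   * |T| = deg v ≥ 13 > 4|C|, so by double counting some y ∈ C lies in at
--     least 5 members of T; since {y} is not a cover, some member {a,b} of T
--     misses y.
--   * A vertex outside C lies in at most |C| ≤ 3 members of T.
--   * Every neighbour x ∉ {a,b} of y in the trace graph has trace degree at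
--     least 11: an edge through x missing v must contain y (else it would hold
--     x and three further neighbours of y), and is then {x,y,a} or {x,y,b}
--     (else a messy path appears); so at most 2 of its ≥ 13 edges miss v.
--   * Hence y and three of its neighbours outside {a,b} all lie in C: 4 ≤ |C|.

open import Defs

open import Data.Nat using (ℕ; zero; suc; _+_; _*_; _≤_; _<_; _≥_; _≤?_; z≤n; s≤s)
open import Data.Nat.Properties
  using (≤-refl; ≤-trans; ≤-reflexive; n≤1+n; m≤m+n; *-monoˡ-≤; +-mono-≤; +-cancelʳ-≤; ≰⇒>; <⇒≱; <-irrefl; module ≤-Reasoning)
open import Data.Bool.Properties using () renaming (_≟_ to _≟ᵇ_)
open import Data.Fin using (Fin; zero; suc)
open import Data.Fin.Properties using (suc-injective) renaming (_≟_ to _≟ᶠ_)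
open import Data.Fin.Subset using (Subset; inside; outside; ⁅_⁆; _∪_; _-_; ∣_∣; _∈_; _∉_; _⊆_)
open import Data.Fin.Subset.Properties
  using (_∈?_; _⊆?_; ⊆-antisym; x∈p∪q⁺; x∈p∪q⁻; x∈p∩q⁺; x∈p∩q⁻; x∈⁅x⁆; x∈⁅y⁆⇒x≡y; p─q⊆p; x∈p∧x≢y⇒x∈p-y; ∣⁅x⁆∣≡1)
open import Data.Vec.Base using (_∷_; []) renaming (here to vhere; there to vthere)
open import Data.Vec.Properties using (≡-dec)
open import Data.List using (List; []; _∷_; _++_; length; map; filter; concatMap)
open import Data.List.Properties using (length-map; length-++; length-removeAt′; map-∘; map-id-local)
open import Data.List.Relation.Unary.All using (All; []; _∷_; all?; tabulate; universal; zip) renaming (map to all-map; lookup to all-lookup)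
open import Data.List.Relation.Unary.All.Properties using (¬All⇒Any¬; ¬Any⇒All¬; all-filter) renaming (map⁺ to all-map⁺)
open import Data.List.Relation.Unary.Any using (here; there; _─_; index)
open import Data.List.Relation.Unary.AllPairs using ([]; _∷_)
open import Data.List.Relation.Unary.Unique.Propositional using (Unique)
import Data.List.Relation.Unary.Unique.Propositional.Properties as Unique
import Data.List.Membership.DecPropositional as DecMembership
open import Data.List.Membership.Propositional using (find; lose) renaming (_∈_ to _∈ₗ_; _∉_ to _∉ₗ_)
open import Data.List.Membership.Propositional.Properties
  using (∈-map⁺; ∈-map⁻; ∈-filter⁺; ∈-filter⁻; ∈-map∘filter⁻; ∈-++⁺ˡ; ∈-++⁺ʳ; ∈-concatMap⁺)
open import Data.Product using (Σ; ∃; _×_; _,_; proj₁; proj₂)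
open import Data.Sum using (_⊎_; inj₁; inj₂) renaming (map to sum-map)
open import Data.Empty using (⊥; ⊥-elim)
open import Function using (_∘_)
open import Relation.Binary.Definitions using (DecidableEquality)
open import Relation.Binary.PropositionalEquality using (_≡_; _≢_; refl; sym; trans; cong; subst; subst₂; ≢-sym)
open import Relation.Nullary using (¬_; yes; no)

private
  variable
    n : ℕ
    A : Set
    a b c i u x y : Fin n
    p e : Subset n

∈-─⁺ : ∀ {x z : A} {ys} (x∈ys : x ∈ₗ ys) → z ∈ₗ ys → z ≢ x → z ∈ₗ (ys ─ x∈ys)
∈-─⁺ (here refl) (here refl)   z≢x = ⊥-elim (z≢x refl)
∈-─⁺ (here refl) (there z∈ys)  _   = z∈ys
∈-─⁺ (there _)   (here refl)   _   = here refl
∈-─⁺ (there x∈ys) (there z∈ys) z≢x = there (∈-─⁺ x∈ys z∈ys z≢x)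

unique⇒length≤ : ∀ {xs ys : List A} → Unique xs → All (_∈ₗ ys) xs → length xs ≤ length ys
unique⇒length≤ {xs = []} _ _ = z≤n
unique⇒length≤ {xs = x ∷ xs} {ys = ys} (x≢xs ∷ xs-unique) (x∈ys ∷ xs⊆ys) =
  ≤-trans (s≤s (unique⇒length≤ xs-unique (all-map shrink (zip (x≢xs , xs⊆ys)))))
          (≤-reflexive (sym (length-removeAt′ ys (index x∈ys))))
  where
  shrink : ∀ {z} → x ≢ z × z ∈ₗ ys → z ∈ₗ (ys ─ x∈ys)
  shrink (x≢z , z∈ys) = ∈-─⁺ x∈ys z∈ys (≢-sym x≢z)

unique-avoid : ∀ {xs ys : List A} → DecidableEquality A → Unique xs → length ys < length xs → ∃ λ x → x ∈ₗ xs × x ∉ₗ ys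
unique-avoid {xs = xs} {ys = ys} _≟_ xs-unique ys<xs with all? (λ x → DecMembership._∈?_ _≟_ x ys) xs
... | yes xs⊆ys = ⊥-elim (<⇒≱ ys<xs (unique⇒length≤ xs-unique xs⊆ys))
... | no  xs⊈ys = find (¬All⇒Any¬ (λ x → DecMembership._∈?_ _≟_ x ys) xs xs⊈ys)

nonempty-member : ∀ {xs : List A} → 0 < length xs → ∃ λ x → x ∈ₗ xs
nonempty-member {xs = x ∷ _} _ = x , here refl

length-concatMap≤ : ∀ {B : Set} {k} (f : A → List B) (ds : List A) →
  All (λ d → length (f d) ≤ k) ds → length (concatMap f ds) ≤ length ds * k
length-concatMap≤ f []       []            = z≤n
length-concatMap≤ f (d ∷ ds) (fd≤k ∷ fds≤k) =
  ≤-trans (≤-reflexive (length-++ (f d))) (+-mono-≤ fd≤k (length-concatMap≤ f ds fds≤k))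

elements : Subset n → List (Fin n)
elements []            = []
elements (inside  ∷ p) = zero ∷ map suc (elements p)
elements (outside ∷ p) = map suc (elements p)

elements-length : (p : Subset n) → length (elements p) ≡ ∣ p ∣
elements-length []            = refl
elements-length (inside  ∷ p) = cong suc (trans (length-map suc (elements p)) (elements-length p))
elements-length (outside ∷ p) = trans (length-map suc (elements p)) (elements-length p)

elements-unique : (p : Subset n) → Unique (elements p)
elements-unique []            = []
elements-unique (inside  ∷ p) =
  all-map⁺ (universal (λ _ ()) (elements p)) ∷ Unique.map⁺ suc-injective (elements-unique p)
elements-unique (outside ∷ p) = Unique.map⁺ suc-injective (elements-unique p)

elements-sound : (p : Subset n) → i ∈ₗ elements p → i ∈ p
elements-sound (inside ∷ p) (here refl) = vhere
elements-sound (inside ∷ p) (there i∈) with ∈-map⁻ suc i∈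
... | j , j∈ , refl = vthere (elements-sound p j∈)
elements-sound (outside ∷ p) i∈ with ∈-map⁻ suc i∈
... | j , j∈ , refl = vthere (elements-sound p j∈)

elements-complete : (p : Subset n) → i ∈ p → i ∈ₗ elements p
elements-complete (inside  ∷ p) vhere       = here refl
elements-complete (inside  ∷ p) (vthere i∈) = there (∈-map⁺ suc (elements-complete p i∈))
elements-complete (outside ∷ p) (vthere i∈) = ∈-map⁺ suc (elements-complete p i∈)

unique⊆⇒length≤∣∣ : ∀ {xs : List (Fin n)} → Unique xs → All (_∈ p) xs → length xs ≤ ∣ p ∣
unique⊆⇒length≤∣∣ {p = p} xs-unique xs⊆p =
  subst (_ ≤_) (elements-length p) (unique⇒length≤ xs-unique (all-map (elements-complete p) xs⊆p))

avoid-subset : (p : Subset n) {xs : List (Fin n)} → length xs < ∣ p ∣ → ∃ λ x → x ∈ p × x ∉ₗ xs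
avoid-subset p xs<p with unique-avoid _≟ᶠ_ (elements-unique p) (subst (_ <_) (sym (elements-length p)) xs<p)
... | x , x∈ , x∉xs = x , elements-sound p x∈ , x∉xs

y∉p-y : (p : Subset n) (y : Fin n) → y ∉ p - y
y∉p-y (_ ∷ p) zero    ()
y∉p-y (_ ∷ p) (suc y) (vthere y∈) = y∉p-y p y y∈

x∈p-y⇒x≢y : x ∈ p - y → x ≢ y
x∈p-y⇒x≢y {p = p} x∈ refl = y∉p-y p _ x∈

x∈p-y⇒x∈p : x ∈ p - y → x ∈ p
x∈p-y⇒x∈p {p = p} {y = y} = p─q⊆p p ⁅ y ⁆

∉∧∈⇒≢ : x ∉ p → y ∈ p → x ≢ y
∉∧∈⇒≢ x∉p y∈p refl = x∉p y∈p

reinsert : x ∈ p → (p - x) ∪ ⁅ x ⁆ ≡ p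
reinsert {x = x} {p = p} x∈p = ⊆-antisym ⊆p p⊆
  where
  ⊆p : (p - x) ∪ ⁅ x ⁆ ⊆ p
  ⊆p i∈ with x∈p∪q⁻ (p - x) ⁅ x ⁆ i∈
  ... | inj₁ i∈p-x = x∈p-y⇒x∈p i∈p-x
  ... | inj₂ i∈⁅x⁆ = subst (_∈ p) (sym (x∈⁅y⁆⇒x≡y x i∈⁅x⁆)) x∈p
  p⊆ : p ⊆ (p - x) ∪ ⁅ x ⁆
  p⊆ {i} i∈p with i ≟ᶠ x
  ... | yes refl = x∈p∪q⁺ (inj₂ (x∈⁅x⁆ x))
  ... | no  i≢x  = x∈p∪q⁺ (inj₁ (x∈p∧x≢y⇒x∈p-y i∈p i≢x))

pair : Fin n → Fin n → Subset n
pair u c = ⁅ u ⁆ ∪ ⁅ c ⁆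

∈-pair⁺ : i ≡ u ⊎ i ≡ c → i ∈ pair u c
∈-pair⁺ {u = u} (inj₁ refl) = x∈p∪q⁺ (inj₁ (x∈⁅x⁆ u))
∈-pair⁺ {c = c} (inj₂ refl) = x∈p∪q⁺ (inj₂ (x∈⁅x⁆ c))

∈-pair⁻ : i ∈ pair u c → i ≡ u ⊎ i ≡ c
∈-pair⁻ {u = u} {c = c} i∈ = sum-map (x∈⁅y⁆⇒x≡y u) (x∈⁅y⁆⇒x≡y c) (x∈p∪q⁻ ⁅ u ⁆ ⁅ c ⁆ i∈)

∈-triple⁺ : i ≡ a ⊎ i ≡ b ⊎ i ≡ c → i ∈ triple a b c
∈-triple⁺ {a = a} (inj₁ refl) = x∈p∪q⁺ (inj₁ (x∈⁅x⁆ a))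
∈-triple⁺ (inj₂ i∈bc)         = x∈p∪q⁺ (inj₂ (∈-pair⁺ i∈bc))

∈-triple⁻ : i ∈ triple a b c → i ≡ a ⊎ i ≡ b ⊎ i ≡ c
∈-triple⁻ {a = a} {b = b} {c = c} i∈ = sum-map (x∈⁅y⁆⇒x≡y a) ∈-pair⁻ (x∈p∪q⁻ ⁅ a ⁆ (pair b c) i∈)

pair⊆ : u ∈ p → c ∈ p → pair u c ⊆ p
pair⊆ u∈p c∈p i∈ with ∈-pair⁻ i∈
... | inj₁ refl = u∈p
... | inj₂ refl = c∈p

triple⊆ : a ∈ p → b ∈ p → c ∈ p → triple a b c ⊆ p
triple⊆ a∈p b∈p c∈p i∈ with ∈-triple⁻ i∈
... | inj₁ refl = a∈p
... | inj₂ i∈bc = pair⊆ b∈p c∈p (∈-pair⁺ i∈bc)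

only-three : ∣ e ∣ ≡ 3 → a ∈ e → b ∈ e → c ∈ e → a ≢ b → a ≢ c → b ≢ c →
  i ∈ e → i ≡ a ⊎ i ≡ b ⊎ i ≡ c
only-three {a = a} {b = b} {c = c} {i = i} ∣e∣≡3 a∈ b∈ c∈ a≢b a≢c b≢c i∈ with i ≟ᶠ a | i ≟ᶠ b | i ≟ᶠ c
... | yes i≡a | _       | _       = inj₁ i≡a
... | no _    | yes i≡b | _       = inj₂ (inj₁ i≡b)
... | no _    | no _    | yes i≡c = inj₂ (inj₂ i≡c)
... | no i≢a  | no i≢b  | no i≢c  =
  ⊥-elim (<-irrefl refl (subst (4 ≤_) ∣e∣≡3 (unique⊆⇒length≤∣∣ four-distinct (a∈ ∷ b∈ ∷ c∈ ∷ i∈ ∷ []))))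
  where
  four-distinct : Unique (a ∷ b ∷ c ∷ i ∷ [])
  four-distinct = (a≢b ∷ a≢c ∷ ≢-sym i≢a ∷ []) ∷ (b≢c ∷ ≢-sym i≢b ∷ []) ∷ (≢-sym i≢c ∷ []) ∷ [] ∷ []

triple-eq : ∣ e ∣ ≡ 3 → a ∈ e → b ∈ e → c ∈ e → a ≢ b → a ≢ c → b ≢ c → e ≡ triple a b c
triple-eq ∣e∣≡3 a∈ b∈ c∈ a≢b a≢c b≢c =
  ⊆-antisym (∈-triple⁺ ∘ only-three ∣e∣≡3 a∈ b∈ c∈ a≢b a≢c b≢c) (triple⊆ a∈ b∈ c∈)

third : ∣ e ∣ ≡ 3 → (a b : Fin n) → ∃ λ c → c ∈ e × c ≢ a × c ≢ b
third {e = e} ∣e∣≡3 a b with avoid-subset e {a ∷ b ∷ []} (subst (2 <_) (sym ∣e∣≡3) ≤-refl)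
... | c , c∈e , c∉ab = c , c∈e , c∉ab ∘ here , c∉ab ∘ there ∘ here

uncovered-member : (L : List (Subset n)) (y : Fin n) → ¬ IsCover L ⁅ y ⁆ → ∃ λ t → t ∈ₗ L × y ∉ t
uncovered-member L y not-cover with all? (y ∈?_) L
... | yes all∋y = ⊥-elim (not-cover (all-map (λ y∈t → y , x∈p∩q⁺ (y∈t , x∈⁅x⁆ y)) all∋y))
... | no  not-all = find (¬All⇒Any¬ (y ∈?_) L not-all)

crowded-vertex : ∀ {L : List (Subset n)} {C} k → Unique L → IsCover L C → ∣ C ∣ * k < length L →
  ∃ λ c → c ∈ C × k < length (filter (c ∈?_) L)
crowded-vertex {L = L} {C} k L-unique cov small with all? (λ c → length (filter (c ∈?_) L) ≤? k) (elements C)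
... | yes all≤k = ⊥-elim (<⇒≱ small (begin
  length L                                 ≤⟨ unique⇒length≤ L-unique (tabulate via-cover) ⟩
  length (concatMap members (elements C))  ≤⟨ length-concatMap≤ members (elements C) all≤k ⟩
  length (elements C) * k                  ≡⟨ cong (_* k) (elements-length C) ⟩
  ∣ C ∣ * k                                ∎))
  where
  open ≤-Reasoning
  members : Fin _ → List (Subset _)
  members c = filter (c ∈?_) L
  via-cover : ∀ {t} → t ∈ₗ L → t ∈ₗ concatMap members (elements C)
  via-cover t∈L with x∈p∩q⁻ _ C (proj₂ (all-lookup cov t∈L))
  ... | c∈t , c∈C = ∈-concatMap⁺ members (lose (elements-complete C c∈C) (∈-filter⁺ (_ ∈?_) t∈L c∈t))
... | no not-all with find (¬All⇒Any¬ (λ c → length (filter (c ∈?_) L) ≤? k) (elements C) not-all)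
...   | c , c∈ , c-crowded = c , elements-sound C c∈ , ≰⇒> c-crowded

module Induced (H : Hypergraph3 n) (W : Subset n) where

  E : List (Subset n)
  E = edgesIn H W

  E⁻ : e ∈ₗ E → e ∈ₗ edges H × e ⊆ W
  E⁻ = ∈-filter⁻ (_⊆? W)

  E-size : e ∈ₗ E → ∣ e ∣ ≡ 3
  E-size e∈E = all-lookup (uniform H) (proj₁ (E⁻ e∈E))

  E-unique : Unique E
  E-unique = Unique.filter⁺ (_⊆? W) (simple H)

  Joint : Fin n → Fin n → Fin n → Set
  Joint a b c = Σ (Subset n) λ e → e ∈ₗ E × a ∈ e × b ∈ e × c ∈ e

  Joint-rotate : Joint a b c → Joint b c a
  Joint-rotate (e , e∈E , a∈ , b∈ , c∈) = e , e∈E , b∈ , c∈ , a∈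

  Joint⇒∈W : Joint a b c → a ∈ W
  Joint⇒∈W (e , e∈E , a∈ , _) = proj₂ (E⁻ e∈E) a∈

  Joint⇒triple : Joint a b c → a ≢ b → a ≢ c → b ≢ c → triple a b c ∈ₗ edges H
  Joint⇒triple (e , e∈E , a∈ , b∈ , c∈) a≢b a≢c b≢c =
    subst (_∈ₗ edges H) (triple-eq (E-size e∈E) a∈ b∈ c∈ a≢b a≢c b≢c) (proj₁ (E⁻ e∈E))

  messy-free : ∀ {a b c d e f} → ¬ ContainsMessyPath H → Unique (a ∷ b ∷ c ∷ d ∷ e ∷ f ∷ []) →
    Joint a b c → Joint b c d → Joint d e f → ⊥
  messy-free noM ((a≢b ∷ a≢c ∷ a≢d ∷ a≢e ∷ a≢f ∷ []) ∷ (b≢c ∷ b≢d ∷ b≢e ∷ b≢f ∷ []) ∷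
                  (c≢d ∷ c≢e ∷ c≢f ∷ []) ∷ (d≢e ∷ d≢f ∷ []) ∷ (e≢f ∷ []) ∷ [] ∷ []) abc bcd def =
    noM (_ , _ , _ , _ , _ , _ ,
         a≢b , a≢c , a≢d , a≢e , a≢f , b≢c , b≢d , b≢e , b≢f , c≢d , c≢e , c≢f , d≢e , d≢f , e≢f ,
         Joint⇒triple abc a≢b a≢c b≢c , Joint⇒triple bcd b≢c b≢d c≢d , Joint⇒triple def d≢e d≢f e≢f)

  module Trace (v : Fin n) where

    T : List (Subset n)
    T = trace H W v

    tdeg : Fin n → ℕ
    tdeg u = length (filter (u ∈?_) T)

    T-length : length T ≡ degIn H W v
    T-length = length-map (_- v) (filter (v ∈?_) E)

    trace⁺ : e ∈ₗ E → v ∈ e → e - v ∈ₗ T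
    trace⁺ e∈E v∈e = ∈-map⁺ (_- v) (∈-filter⁺ (v ∈?_) e∈E v∈e)

    trace⁻ : ∀ {t} → t ∈ₗ T → ∃ λ e → e ∈ₗ E × v ∈ e × t ≡ e - v
    trace⁻ t∈T with ∈-map∘filter⁻ (_- v) (v ∈?_) t∈T
    ... | e , e∈E , t≡e-v , v∈e = e , e∈E , v∈e , t≡e-v

    -- Adding v back to the trace recovers the edges through v; so T has no repeats.
    T-restore : map (_∪ ⁅ v ⁆) T ≡ filter (v ∈?_) E
    T-restore = trans (sym (map-∘ (filter (v ∈?_) E))) (map-id-local (all-map reinsert (all-filter (v ∈?_) E)))

    T-unique : Unique T
    T-unique = Unique.map⁻ (subst Unique (sym T-restore) (Unique.filter⁺ (v ∈?_) E-unique))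

    trace-≢v : ∀ {t} → t ∈ₗ T → u ∈ t → u ≢ v
    trace-≢v t∈T u∈t with trace⁻ t∈T
    ... | _ , _ , _ , refl = x∈p-y⇒x≢y u∈t

    trace-joint : ∀ {t} → t ∈ₗ T → u ∈ t → c ∈ t → Joint u c v
    trace-joint t∈T u∈t c∈t with trace⁻ t∈T
    ... | e , e∈E , v∈e , refl = e , e∈E , x∈p-y⇒x∈p u∈t , x∈p-y⇒x∈p c∈t , v∈e

    trace-other : ∀ {t} → t ∈ₗ T → (u : Fin n) → ∃ λ c → c ∈ t × c ≢ u
    trace-other t∈T u with trace⁻ t∈T
    ... | e , e∈E , v∈e , refl with third (E-size e∈E) v u
    ...   | c , c∈e , c≢v , c≢u = c , x∈p∧x≢y⇒x∈p-y c∈e c≢v , c≢u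

    trace-pair : ∀ {t} → t ∈ₗ T → u ∈ t → c ∈ t → u ≢ c → t ≡ pair u c
    trace-pair {u = u} {c = c} t∈T u∈t c∈t u≢c with trace⁻ t∈T
    ... | e , e∈E , v∈e , refl = ⊆-antisym ⊆pair (pair⊆ u∈t c∈t)
      where
      ⊆pair : e - v ⊆ pair u c
      ⊆pair i∈ with only-three (E-size e∈E) v∈e (x∈p-y⇒x∈p u∈t) (x∈p-y⇒x∈p c∈t)
                      (≢-sym (x∈p-y⇒x≢y u∈t)) (≢-sym (x∈p-y⇒x≢y c∈t)) u≢c (x∈p-y⇒x∈p i∈)
      ... | inj₁ i≡v  = ⊥-elim (x∈p-y⇒x≢y i∈ i≡v)
      ... | inj₂ i∈uc = ∈-pair⁺ i∈uc

    tdeg-pos⇒≢v : 0 < tdeg u → u ≢ v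
    tdeg-pos⇒≢v {u = u} pos with ∈-filter⁻ (u ∈?_) (proj₂ (nonempty-member pos))
    ... | t∈T , u∈t = trace-≢v t∈T u∈t

    degree-split : x ≢ v → (extra : List (Subset n)) →
      (∀ {f} → f ∈ₗ E → x ∈ f → v ∉ f → f ∈ₗ extra) → degIn H W x ≤ tdeg x + length extra
    degree-split {x = x} x≢v extra elsewhere = begin
      degIn H W x                      ≤⟨ unique⇒length≤ (Unique.filter⁺ (x ∈?_) E-unique) (tabulate classify) ⟩
      length (via-trace ++ extra)      ≡⟨ length-++ via-trace ⟩
      length via-trace + length extra  ≡⟨ cong (_+ length extra) (length-map (_∪ ⁅ v ⁆) (filter (x ∈?_) T)) ⟩
      tdeg x + length extra            ∎
      where
      open ≤-Reasoning
      via-trace : List (Subset n)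
      via-trace = map (_∪ ⁅ v ⁆) (filter (x ∈?_) T)
      classify : ∀ {f} → f ∈ₗ filter (x ∈?_) E → f ∈ₗ via-trace ++ extra
      classify {f} f∈ with ∈-filter⁻ (x ∈?_) f∈
      ... | f∈E , x∈f with v ∈? f
      ...   | no  v∉f = ∈-++⁺ʳ via-trace (elsewhere f∈E x∈f v∉f)
      ...   | yes v∈f = ∈-++⁺ˡ (subst (_∈ₗ via-trace) (reinsert v∈f)
                          (∈-map⁺ (_∪ ⁅ v ⁆) (∈-filter⁺ (x ∈?_) (trace⁺ f∈E v∈f) (x∈p∧x≢y⇒x∈p-y x∈f x≢v))))

    Nbr : Fin n → Fin n → Set
    Nbr y x = Joint x y v × x ≢ v × x ≢ y

    fresh-neighbour : (y : Fin n) (zs : List (Fin n)) → length zs < tdeg y → ∃ λ x → Nbr y x × x ∉ₗ zs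
    fresh-neighbour y zs zs<tdeg
      with unique-avoid (≡-dec _≟ᵇ_) (Unique.filter⁺ (y ∈?_) T-unique)
                        (subst (_< tdeg y) (sym (length-map (pair y) zs)) zs<tdeg)
    ... | t , t∈ , t∉ with ∈-filter⁻ (y ∈?_) t∈
    ...   | t∈T , y∈t with trace-other t∈T y
    ...     | x , x∈t , x≢y = x , (trace-joint t∈T x∈t y∈t , trace-≢v t∈T x∈t , x≢y) , x∉zs
      where
      x∉zs : x ∉ₗ zs
      x∉zs x∈zs = t∉ (subst (_∈ₗ map (pair y) zs) (sym (trace-pair t∈T y∈t x∈t (≢-sym x≢y))) (∈-map⁺ (pair y) x∈zs))

    Neighbours : Fin n → ℕ → List (Fin n) → Set
    Neighbours y k zs = ∃ λ xs → length xs ≡ k × Unique xs × All (λ x → Nbr y x × x ∉ₗ zs) xs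

    neighbours : (y : Fin n) (k : ℕ) (zs : List (Fin n)) → k + length zs ≤ tdeg y → Neighbours y k zs
    neighbours y zero    zs _    = [] , refl , [] , []
    neighbours y (suc k) zs room with neighbours y k zs (≤-trans (n≤1+n _) room)
    ... | xs , refl , xs-unique , xs-ok
      with fresh-neighbour y (xs ++ zs) (subst (_< tdeg y) (sym (length-++ xs)) room)
    ...   | x , x-nbr , x∉ = x ∷ xs , refl , ¬Any⇒All¬ xs (x∉ ∘ ∈-++⁺ˡ) ∷ xs-unique , (x-nbr , x∉ ∘ ∈-++⁺ʳ xs) ∷ xs-ok

    -- Let C cover T.  A vertex u ∉ C lies only in trace members {u, c} with c ∈ C,
    -- so tdeg u ≤ |C|.  Hence every vertex with tdeg u > |C| belongs to C.
    crowded⇒∈cover : ∀ {C} → IsCover T C → ∣ C ∣ < tdeg u → u ∈ C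
    crowded⇒∈cover {u = u} {C} cov crowded with u ∈? C
    ... | yes u∈C = u∈C
    ... | no  u∉C = ⊥-elim (<⇒≱ crowded (begin
      tdeg u                            ≤⟨ unique⇒length≤ (Unique.filter⁺ (u ∈?_) T-unique) (tabulate as-pair) ⟩
      length (map (pair u) (elements C)) ≡⟨ length-map (pair u) (elements C) ⟩
      length (elements C)               ≡⟨ elements-length C ⟩
      ∣ C ∣                             ∎))
      where
      open ≤-Reasoning
      as-pair : ∀ {t} → t ∈ₗ filter (u ∈?_) T → t ∈ₗ map (pair u) (elements C)
      as-pair t∈ with ∈-filter⁻ (u ∈?_) t∈
      ... | t∈T , u∈t with x∈p∩q⁻ _ C (proj₂ (all-lookup cov t∈T))
      ...   | c∈t , c∈C = subst (_∈ₗ map (pair u) (elements C)) (sym (trace-pair t∈T u∈t c∈t (∉∧∈⇒≢ u∉C c∈C)))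
                            (∈-map⁺ (pair u) (elements-complete C c∈C))

module Core (H : Hypergraph3 n) (noM : ¬ ContainsMessyPath H) (W : Subset n)
            (deg≥13 : ∀ u → u ∈ W → degIn H W u ≥ 13) (v : Fin n) where

  open Induced H W
  open Trace v

  module CrowdedVertex (y : Fin n) (y-crowded : 5 ≤ tdeg y) {t₀} (t₀∈T : t₀ ∈ₗ T) (y∉t₀ : y ∉ t₀)
                {a b} (a∈t₀ : a ∈ t₀) (b∈t₀ : b ∈ t₀) (a≢b : a ≢ b) where

    y≢v : y ≢ v
    y≢v = tdeg-pos⇒≢v (≤-trans (s≤s z≤n) y-crowded)

    -- Let x, o be distinct neighbours of y and f an edge through x missing v and y.
    -- Then o ∈ f, for otherwise {o,y,v}, {y,v,x}, {x,p,q} = f is a messy path.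
    forced : ∀ {x o f} → Nbr y x → Nbr y o → o ≢ x → f ∈ₗ E → x ∈ f → v ∉ f → y ∉ f → o ∈ f
    forced {x} {o} {f} (x-joint , x≢v , x≢y) (o-joint , o≢v , o≢y) o≢x f∈E x∈f v∉f y∉f with o ∈? f
    ... | yes o∈f = o∈f
    ... | no  o∉f with third (E-size f∈E) x x
    ...   | p , p∈f , p≢x , _ with third (E-size f∈E) x p
    ...     | q , q∈f , q≢x , q≢p =
      ⊥-elim (messy-free noM distinct o-joint (Joint-rotate x-joint) (f , f∈E , x∈f , p∈f , q∈f))
      where
      distinct : Unique (o ∷ y ∷ v ∷ x ∷ p ∷ q ∷ [])
      distinct = (o≢y ∷ o≢v ∷ o≢x ∷ ∉∧∈⇒≢ o∉f p∈f ∷ ∉∧∈⇒≢ o∉f q∈f ∷ [])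
               ∷ (y≢v ∷ ≢-sym x≢y ∷ ∉∧∈⇒≢ y∉f p∈f ∷ ∉∧∈⇒≢ y∉f q∈f ∷ [])
               ∷ (≢-sym x≢v ∷ ∉∧∈⇒≢ v∉f p∈f ∷ ∉∧∈⇒≢ v∉f q∈f ∷ [])
               ∷ (≢-sym p≢x ∷ ≢-sym q≢x ∷ [])
               ∷ (≢-sym q≢p ∷ [])
               ∷ [] ∷ []

    -- An edge through a neighbour x of y that misses v contains y: otherwise it
    -- would contain x together with three further neighbours of y.
    through-y : ∀ {x f} → Nbr y x → f ∈ₗ E → x ∈ f → v ∉ f → y ∈ f
    through-y {x} {f} x-nbr f∈E x∈f v∉f with y ∈? f
    ... | yes y∈f = y∈f
    ... | no  y∉f = too-many (neighbours y 3 (x ∷ []) (≤-trans (n≤1+n 4) y-crowded))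
      where
      too-many : Neighbours y 3 (x ∷ []) → y ∈ f
      too-many (os , os-length , os-unique , os-ok) =
        ⊥-elim (<-irrefl refl (subst₂ _≤_ (cong suc os-length) (E-size f∈E) (unique⊆⇒length≤∣∣ distinct inside-f)))
        where
        distinct : Unique (x ∷ os)
        distinct = all-map (λ (_ , o∉x) → ≢-sym (o∉x ∘ here)) os-ok ∷ os-unique
        inside-f : All (_∈ f) (x ∷ os)
        inside-f = x∈f ∷ all-map (λ (o-nbr , o∉x) → forced x-nbr o-nbr (o∉x ∘ here) f∈E x∈f v∉f y∉f) os-ok

    ab-joint : Joint v a b
    ab-joint = Joint-rotate (Joint-rotate (trace-joint t₀∈T a∈t₀ b∈t₀))

    -- An edge through a neighbour x ∉ {a,b} of y and through y, missing v, is
    -- {x,y,a} or {x,y,b}: another third vertex w gives the messy path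
    -- {w,x,y}, {x,y,v}, {v,a,b}.
    through-xy : ∀ {x f} → Nbr y x → x ∉ₗ a ∷ b ∷ [] → f ∈ₗ E → x ∈ f → y ∈ f → v ∉ f →
      f ∈ₗ triple x y a ∷ triple x y b ∷ []
    through-xy {x} {f} (x-joint , x≢v , x≢y) x∉ab f∈E x∈f y∈f v∉f with third (E-size f∈E) x y
    ... | w , w∈f , w≢x , w≢y with w ≟ᶠ a | w ≟ᶠ b
    ...   | yes refl | _        = here (triple-eq (E-size f∈E) x∈f y∈f w∈f x≢y (≢-sym w≢x) (≢-sym w≢y))
    ...   | no _     | yes refl = there (here (triple-eq (E-size f∈E) x∈f y∈f w∈f x≢y (≢-sym w≢x) (≢-sym w≢y)))
    ...   | no w≢a   | no w≢b   =
      ⊥-elim (messy-free noM distinct (f , f∈E , w∈f , x∈f , y∈f) x-joint ab-joint)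
      where
      a≢v : a ≢ v
      a≢v = trace-≢v t₀∈T a∈t₀
      b≢v : b ≢ v
      b≢v = trace-≢v t₀∈T b∈t₀
      distinct : Unique (w ∷ x ∷ y ∷ v ∷ a ∷ b ∷ [])
      distinct = (w≢x ∷ w≢y ∷ ∉∧∈⇒≢ v∉f w∈f ∘ sym ∷ w≢a ∷ w≢b ∷ [])
               ∷ (x≢y ∷ x≢v ∷ x∉ab ∘ here ∷ x∉ab ∘ there ∘ here ∷ [])
               ∷ (y≢v ∷ ∉∧∈⇒≢ y∉t₀ a∈t₀ ∷ ∉∧∈⇒≢ y∉t₀ b∈t₀ ∷ [])
               ∷ (≢-sym a≢v ∷ ≢-sym b≢v ∷ [])
               ∷ (a≢b ∷ [])
               ∷ [] ∷ []

    -- So a neighbour x ∉ {a,b} of y has at most two edges missing v, and since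
    -- deg x ≥ 13 its trace degree is at least 11.
    neighbour-crowded : ∀ {x} → Nbr y x → x ∉ₗ a ∷ b ∷ [] → 11 ≤ tdeg x
    neighbour-crowded {x} x-nbr@(x-joint , x≢v , _) x∉ab =
      +-cancelʳ-≤ 2 11 (tdeg x) (≤-trans (deg≥13 x (Joint⇒∈W x-joint)) (degree-split x≢v _ missing-v))
      where
      missing-v : ∀ {f} → f ∈ₗ E → x ∈ f → v ∉ f → f ∈ₗ triple x y a ∷ triple x y b ∷ []
      missing-v f∈E x∈f v∉f = through-xy x-nbr x∉ab f∈E x∈f (through-y x-nbr f∈E x∈f v∉f) v∉f

    -- A cover of T of size ≤ 3 containing y would contain y and three of its
    -- neighbours outside {a,b}: four distinct vertices.
    no-cover : ∀ {C} → IsCover T C → ∣ C ∣ ≤ 3 → y ∈ C → ⊥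
    no-cover {C} cov ∣C∣≤3 y∈C = too-many (neighbours y 3 (a ∷ b ∷ []) y-crowded)
      where
      too-many : Neighbours y 3 (a ∷ b ∷ []) → ⊥
      too-many (xs , xs-length , xs-unique , xs-ok) =
        <-irrefl refl (≤-trans (subst (_≤ ∣ C ∣) (cong suc xs-length) (unique⊆⇒length≤∣∣ distinct inside-C)) ∣C∣≤3)
        where
        distinct : Unique (y ∷ xs)
        distinct = all-map (λ ((_ , _ , x≢y) , _) → ≢-sym x≢y) xs-ok ∷ xs-unique
        inside-C : All (_∈ C) (y ∷ xs)
        inside-C = y∈C ∷ all-map (λ (x-nbr , x∉ab) →
          crowded⇒∈cover cov (≤-trans (s≤s ∣C∣≤3) (≤-trans (m≤m+n 4 7) (neighbour-crowded x-nbr x∉ab)))) xs-ok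

  -- Let v ∈ W.  A cover C of T with |C| ≤ 3 is impossible unless a single
  -- vertex covers T: as 4|C| < 13 ≤ |T|, some y ∈ C lies in ≥ 5 members of T,
  -- and some member {a, b} of T misses y.
  no-small-cover : v ∈ W → ∀ {C} → IsCover T C → ∣ C ∣ ≤ 3 → (∀ y → ¬ IsCover T ⁅ y ⁆) → ⊥
  no-small-cover v∈W {C} cov ∣C∣≤3 no-singleton
    with crowded-vertex 4 T-unique cov
           (≤-trans (s≤s (*-monoˡ-≤ 4 ∣C∣≤3)) (subst (13 ≤_) (sym T-length) (deg≥13 v v∈W)))
  ... | y , y∈C , y-crowded with uncovered-member T y (no-singleton y)
  ...   | t₀ , t₀∈T , y∉t₀ with trace-other t₀∈T y
  ...     | a , a∈t₀ , _ with trace-other t₀∈T a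
  ...       | b , b∈t₀ , b≢a = CrowdedVertex.no-cover y y-crowded t₀∈T y∉t₀ a∈t₀ b∈t₀ (≢-sym b≢a) cov ∣C∣≤3 y∈C

  cover-number-∉23 : v ∈ W → ∀ {k} → 2 ≤ k → k ≤ 3 → ¬ CoverNumber T k
  cover-number-∉23 v∈W {k} 2≤k k≤3 ((C , cov , ∣C∣≡k) , minimal) =
    no-small-cover v∈W cov (subst (_≤ 3) (sym ∣C∣≡k) k≤3) no-singleton
    where
    no-singleton : ∀ y → ¬ IsCover T ⁅ y ⁆
    no-singleton y cov-y = <-irrefl refl (≤-trans 2≤k (subst (k ≤_) (∣⁅x⁆∣≡1 y) (minimal ⁅ y ⁆ cov-y)))

-- The 13-core W has minimum degree at least 13 in the induced subhypergraph,
-- which is all the argument uses.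
mainTheorem12 : ∀ {n : ℕ} (H : Hypergraph3 n) → ¬ ContainsMessyPath H →
    ∀ (W : Subset n) → IsCore H 13 W →
    ∀ (v : Fin n) → v ∈ W →
      ¬ CoverNumber (trace H W v) 2 × ¬ CoverNumber (trace H W v) 3
mainTheorem12 H noM W (_ , deg≥13) v v∈W =
  Core.cover-number-∉23 H noM W deg≥13 v v∈W ≤-refl (n≤1+n 2) ,
  Core.cover-number-∉23 H noM W deg≥13 v v∈W (n≤1+n 2) ≤-refl
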